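{- For every integer $k>1$, the class of meet-trees of arity at most $k$ equipped with an automorphism does not have the amalgamation property.
   Context: A meet-tree is a structure $(A,\leq,\mathbin{\wedge})$ where $\leq$ is a partial order such that each $A_{\leq a}=\{x:x\leq a\}$ is linearly ordered, any two elements have a common lower bound, and $a\mathbin{\wedge} b$ is the largest element of $A_{\leq a}\cap A_{\leq b}$. A meet-tree has arity at most $k$ if there is no set of $k+1$ elements all of whose pairwise meets equal a single element different from each of them. The class consists of pairs $(B,g)$ with $B$ a meet-tree of arity at most $k$ and $g$ an automorphism of $B$; an embedding $(B,g)\to(C,f)$ is a meet-tree embedding $e\colon B\to C$ with $e\circ g=f\circ e$. Amalgamation property: for any embeddings $(B,g)\to(C_1,f_1)$ and $(B,g)\to(C_2,f_2)$ in the class there is $(D,h)$ in the class and embeddings $(C_i,f_i)\to(D,h)$ such that the two composite embeddings of $(B,g)$ into $(D,h)$ coincide. -}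

module Defs where

open import Data.Nat using (ℕ; suc)
open import Data.Fin using (Fin)
open import Data.Product using (Σ; _×_; _,_)
open import Data.Sum using (_⊎_)
open import Relation.Nullary using (¬_)
open import Relation.Binary.PropositionalEquality using (_≡_; _≢_)
open import Function.Bundles using (_⇔_)
open import Function.Definitions using (Injective; Bijective)

record MeetTree : Set₁ where
  field
    Carrier : Set
    _≤_     : Carrier → Carrier → Set
    _∧_     : Carrier → Carrier → Carrier
    ≤-refl    : ∀ x → x ≤ x
    ≤-antisym : ∀ {x y} → x ≤ y → y ≤ x → x ≡ y
    ≤-trans   : ∀ {x y z} → x ≤ y → y ≤ z → x ≤ z
    downset-linear : ∀ {a x y} → x ≤ a → y ≤ a → (x ≤ y) ⊎ (y ≤ x)
    common-lower   : ∀ a b → Σ Carrier (λ c → (c ≤ a) × (c ≤ b))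
    ∧-lowerˡ : ∀ a b → (a ∧ b) ≤ a
    ∧-lowerʳ : ∀ a b → (a ∧ b) ≤ b
    ∧-greatest : ∀ {a b x} → x ≤ a → x ≤ b → x ≤ (a ∧ b)

open MeetTree public

ArityAtMost : ℕ → MeetTree → Set
ArityAtMost k T =
  ¬ Σ (Fin (suc k) → Carrier T) (λ f →
      Injective _≡_ _≡_ f ×
      Σ (Carrier T) (λ c →
        (∀ i j → i ≢ j → _∧_ T (f i) (f j) ≡ c) ×
        (∀ i → f i ≢ c)))

record IsMeetTreeEmbedding (S T : MeetTree) (e : Carrier S → Carrier T) : Set where
  field
    injective : Injective _≡_ _≡_ e
    ≤-iff     : ∀ x y → (_≤_ S x y) ⇔ (_≤_ T (e x) (e y))
    ∧-hom     : ∀ x y → e (_∧_ S x y) ≡ _∧_ T (e x) (e y)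

record IsAutomorphism (T : MeetTree) (g : Carrier T → Carrier T) : Set where
  field
    bijective : Bijective _≡_ _≡_ g
    embedding : IsMeetTreeEmbedding T T g

record TreeAut (k : ℕ) : Set₁ where
  field
    tree  : MeetTree
    arity : ArityAtMost k tree
    aut   : Carrier tree → Carrier tree
    isAut : IsAutomorphism tree aut

open TreeAut public

record Emb {k : ℕ} (B C : TreeAut k) : Set where
  field
    map   : Carrier (tree B) → Carrier (tree C)
    isEmb : IsMeetTreeEmbedding (tree B) (tree C) map
    comm  : ∀ x → map (aut B x) ≡ aut C (map x)

open Emb public

AmalgamationProperty : ℕ → Set₁
AmalgamationProperty k =
  ∀ (B C₁ C₂ : TreeAut k) (i₁ : Emb B C₁) (i₂ : Emb B C₂) →
  Σ (TreeAut k) (λ D →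
    Σ (Emb C₁ D) (λ j₁ →
      Σ (Emb C₂ D) (λ j₂ →
        ∀ x → map j₁ (map i₁ x) ≡ map j₂ (map i₂ x))))

-- Amalgamate the one-point tree into two stars: the star with two leaves, carrying the
-- automorphism that swaps them, and the star with k leaves, carrying the identity.  In an
-- amalgam with automorphism h, let r be the image of the point, a and h a the swapped leaves
-- and b₁ … bₖ the fixed leaves.  The meets a ∧ bⱼ and h a ∧ bⱼ = h (a ∧ bⱼ) lie in the chain
-- below bⱼ, so the smaller one lies below a ∧ h a = r; as h is injective and fixes r, both
-- equal r.  Hence a, b₁ … bₖ are k + 1 branches at r, which the arity bound forbids.
module Submission where

open import Defs
open import Data.Nat using (ℕ; _<_)
open import Relation.Nullary using (¬_)

open import Data.Nat using (suc; s≤s; z≤n) renaming (_≤_ to _≤ℕ_)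
open import Data.Nat.Properties using (<⇒≤) renaming (≤-refl to ≤ℕ-refl)
open import Data.Fin using (Fin; zero; suc; _≟_)
open import Data.Fin.Properties using (pigeonhole; <⇒≢)
open import Data.Fin.Permutation using (Permutation′; _⟨$⟩ʳ_; _⟨$⟩ˡ_; inverseʳ; id; transpose)
open import Data.Maybe using (Maybe; just; nothing)
import Data.Maybe as Maybe
open import Data.Maybe.Properties using (map-injective; map-∘; map-cong; map-id)
open import Data.Product using (Σ; _×_; _,_; proj₁; proj₂)
open import Data.Sum using (_⊎_; inj₁; inj₂)
open import Data.Empty using (⊥; ⊥-elim)
open import Data.Vec.Functional using (_∷_)
open import Relation.Nullary using (yes; no)
open import Relation.Binary.PropositionalEquality
open import Function using (_∘_)
open import Function.Bundles using (mk⇔; Equivalence; Injection)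
open import Function.Definitions using (Injective)
open import Function.Properties.Inverse using (↔⇒↣)
open import Function.Consequences.Propositional using (strictlySurjective⇒surjective)

variable
  k m n : ℕ

module MeetTreeProperties (T : MeetTree) where
  open MeetTree T public using () renaming
    ( _≤_ to _⊑_; _∧_ to _⊓_; ≤-refl to ⊑-refl; ≤-antisym to ⊑-antisym; ≤-trans to ⊑-trans
    ; downset-linear to ⊑-downset-linear
    ; ∧-lowerˡ to ⊓-lowerˡ; ∧-lowerʳ to ⊓-lowerʳ; ∧-greatest to ⊓-greatest )

  ⊓-comm : ∀ x y → x ⊓ y ≡ y ⊓ x
  ⊓-comm x y = ⊑-antisym (⊓-greatest (⊓-lowerʳ x y) (⊓-lowerˡ x y))
                         (⊓-greatest (⊓-lowerʳ y x) (⊓-lowerˡ y x))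

  ⊓-idem : ∀ x → x ⊓ x ≡ x
  ⊓-idem x = ⊑-antisym (⊓-lowerˡ x x) (⊓-greatest (⊑-refl x) (⊑-refl x))

  ⊓⊑⊓⇒⊑⊓ : ∀ {x y z} → (x ⊓ z) ⊑ (y ⊓ z) → (x ⊓ z) ⊑ (x ⊓ y)
  ⊓⊑⊓⇒⊑⊓ {x} {y} {z} p = ⊓-greatest (⊓-lowerˡ x z) (⊑-trans p (⊓-lowerˡ y z))

  IsStar : (Fin n → Carrier T) → Carrier T → Set
  IsStar f c = (∀ i j → i ≢ j → f i ⊓ f j ≡ c) × (∀ i → f i ≢ c)

  star-injective : ∀ {f : Fin n → Carrier T} {c} → IsStar f c → Injective _≡_ _≡_ f
  star-injective {f = f} {c} (meets , leaves) {i} {j} fi≡fj with i ≟ j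
  ... | yes i≡j = i≡j
  ... | no i≢j = ⊥-elim (leaves i (begin
    f i       ≡⟨ sym (⊓-idem (f i)) ⟩
    f i ⊓ f i ≡⟨ cong (f i ⊓_) fi≡fj ⟩
    f i ⊓ f j ≡⟨ meets i j i≢j ⟩
    c         ∎))
    where open ≡-Reasoning

  star-∷ : ∀ {a c} {b : Fin n → Carrier T} → IsStar b c → a ≢ c →
           (∀ j → a ⊓ b j ≡ c) → IsStar (a ∷ b) c
  star-∷ {a = a} {c} {b} (meets , leaves) a≢c a⊓b≡c = meets′ , leaves′
    where
    meets′ : ∀ i j → i ≢ j → (a ∷ b) i ⊓ (a ∷ b) j ≡ c
    meets′ zero    zero    i≢j = ⊥-elim (i≢j refl)
    meets′ zero    (suc j) _   = a⊓b≡c j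
    meets′ (suc i) zero    _   = trans (⊓-comm (b i) a) (a⊓b≡c i)
    meets′ (suc i) (suc j) i≢j = meets i j (i≢j ∘ cong suc)
    leaves′ : ∀ i → (a ∷ b) i ≢ c
    leaves′ zero    = a≢c
    leaves′ (suc i) = leaves i

  arity⇒¬star : ArityAtMost k T → ∀ {f : Fin (suc k) → Carrier T} {c} → ¬ IsStar f c
  arity⇒¬star arity {f} {c} star = arity (f , star-injective star , c , star)

  ⊓-fixed-point : ∀ {h} → IsMeetTreeEmbedding T T h → ∀ {a c r} →
                  h r ≡ r → h c ≡ c → r ⊑ c → a ⊓ h a ≡ r → a ⊓ c ≡ r
  ⊓-fixed-point {h} h-emb {a} {c} {r} hr≡r hc≡c r⊑c a⊓ha≡r
    with ⊑-downset-linear (⊓-lowerʳ a c) (⊓-lowerʳ (h a) c)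
  ... | inj₁ a⊓c⊑ha⊓c = ⊑-antisym (subst (_ ⊑_) a⊓ha≡r (⊓⊑⊓⇒⊑⊓ a⊓c⊑ha⊓c)) r⊑a⊓c
    where
    r⊑a⊓c : r ⊑ (a ⊓ c)
    r⊑a⊓c = ⊓-greatest (subst (_⊑ a) a⊓ha≡r (⊓-lowerˡ a (h a))) r⊑c
  ... | inj₂ ha⊓c⊑a⊓c = IsMeetTreeEmbedding.injective h-emb (begin
    h (a ⊓ c)   ≡⟨ IsMeetTreeEmbedding.∧-hom h-emb a c ⟩
    h a ⊓ h c   ≡⟨ cong (h a ⊓_) hc≡c ⟩
    h a ⊓ c     ≡⟨ ⊑-antisym (subst (_ ⊑_) ha⊓a≡r (⊓⊑⊓⇒⊑⊓ ha⊓c⊑a⊓c)) r⊑ha⊓c ⟩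
    r           ≡⟨ hr≡r ⟨
    h r         ∎)
    where
    open ≡-Reasoning
    ha⊓a≡r : h a ⊓ a ≡ r
    ha⊓a≡r = trans (⊓-comm (h a) a) a⊓ha≡r
    r⊑ha⊓c : r ⊑ (h a ⊓ c)
    r⊑ha⊓c = ⊓-greatest (subst (_⊑ h a) a⊓ha≡r (⊓-lowerʳ a (h a))) r⊑c

infix 4 _≼_

data _≼_ {n} : Maybe (Fin n) → Maybe (Fin n) → Set where
  root≼ : ∀ {y} → nothing ≼ y
  leaf≼ : ∀ {i} → just i ≼ just i

infixr 7 _⋏_

_⋏_ : Maybe (Fin n) → Maybe (Fin n) → Maybe (Fin n)
nothing ⋏ y       = nothing
just i  ⋏ nothing = nothing
just i  ⋏ just j  with i ≟ j
... | yes _ = just i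
... | no _  = nothing

⋏-self : ∀ (i : Fin n) → just i ⋏ just i ≡ just i
⋏-self i with i ≟ i
... | yes _  = refl
... | no i≢i = ⊥-elim (i≢i refl)

⋏-≢ : ∀ {i j : Fin n} → i ≢ j → just i ⋏ just j ≡ nothing
⋏-≢ {i = i} {j} i≢j with i ≟ j
... | yes i≡j = ⊥-elim (i≢j i≡j)
... | no _    = refl

⋏≡just⇒≡ : ∀ {x y} {i : Fin n} → x ⋏ y ≡ just i → x ≡ just i
⋏≡just⇒≡ {x = just i} {just j} x⋏y≡ with i ≟ j
⋏≡just⇒≡ {x = just i} {just j} refl | yes _ = refl

just≼just⇒≡ : ∀ {i j : Fin n} → just i ≼ just j → i ≡ j
just≼just⇒≡ leaf≼ = refl

star : ℕ → MeetTree
star n = record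
  { Carrier = Maybe (Fin n) ; _≤_ = _≼_ ; _∧_ = _⋏_
  ; ≤-refl = refl≼ ; ≤-antisym = antisym≼ ; ≤-trans = trans≼
  ; downset-linear = linear≼
  ; common-lower = λ _ _ → nothing , root≼ , root≼
  ; ∧-lowerˡ = lowerˡ ; ∧-lowerʳ = lowerʳ ; ∧-greatest = greatest }
  where
  refl≼ : ∀ x → x ≼ x
  refl≼ nothing  = root≼
  refl≼ (just i) = leaf≼
  antisym≼ : ∀ {x y} → x ≼ y → y ≼ x → x ≡ y
  antisym≼ root≼ root≼ = refl
  antisym≼ leaf≼ _     = refl
  trans≼ : ∀ {x y z} → x ≼ y → y ≼ z → x ≼ z
  trans≼ root≼ _ = root≼
  trans≼ leaf≼ q = q
  linear≼ : ∀ {a x y} → x ≼ a → y ≼ a → x ≼ y ⊎ y ≼ x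
  linear≼ root≼ _     = inj₁ root≼
  linear≼ leaf≼ root≼ = inj₂ root≼
  linear≼ leaf≼ leaf≼ = inj₁ leaf≼
  lowerˡ : ∀ x y → (x ⋏ y) ≼ x
  lowerˡ nothing  y        = root≼
  lowerˡ (just i) nothing  = root≼
  lowerˡ (just i) (just j) with i ≟ j
  ... | yes _ = leaf≼
  ... | no _  = root≼
  lowerʳ : ∀ x y → (x ⋏ y) ≼ y
  lowerʳ nothing  y        = root≼
  lowerʳ (just i) nothing  = root≼
  lowerʳ (just i) (just j) with i ≟ j
  ... | yes refl = leaf≼
  ... | no _     = root≼
  greatest : ∀ {x y z} → z ≼ x → z ≼ y → z ≼ (x ⋏ y)
  greatest root≼ _ = root≼
  greatest (leaf≼ {i}) leaf≼ = subst (just i ≼_) (sym (⋏-self i)) leaf≼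

≢nothing⇒just : ∀ {A : Set} (x : Maybe A) → x ≢ nothing → Σ A (λ a → x ≡ just a)
≢nothing⇒just nothing  x≢nothing = ⊥-elim (x≢nothing refl)
≢nothing⇒just (just a) _         = a , refl

star-arity : 1 ≤ℕ k → n ≤ℕ k → ArityAtMost k (star n)
star-arity {suc k} _ _ (_ , _ , just i , meets , leaves) =
  leaves zero (⋏≡just⇒≡ (meets zero (suc zero) λ ()))
star-arity {k} {n} _ n≤k (f , f-injective , nothing , _ , leaves)
  with i , j , i<j , leafᵢ≡leafⱼ ← pigeonhole (s≤s n≤k) (λ i → proj₁ (≢nothing⇒just (f i) (leaves i)))
  = <⇒≢ i<j (f-injective (begin
    f i    ≡⟨ proj₂ (≢nothing⇒just (f i) (leaves i)) ⟩
    just _ ≡⟨ cong just leafᵢ≡leafⱼ ⟩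
    just _ ≡⟨ proj₂ (≢nothing⇒just (f j) (leaves j)) ⟨
    f j    ∎))
  where open ≡-Reasoning

star-map-embedding : ∀ {ι : Fin m → Fin n} → Injective _≡_ _≡_ ι →
                     IsMeetTreeEmbedding (star m) (star n) (Maybe.map ι)
star-map-embedding {ι = ι} ι-injective = record
  { injective = map-injective ι-injective
  ; ≤-iff     = λ _ _ → mk⇔ monotone reflecting
  ; ∧-hom     = ⋏-hom }
  where
  monotone : ∀ {x y} → x ≼ y → Maybe.map ι x ≼ Maybe.map ι y
  monotone root≼ = root≼
  monotone leaf≼ = leaf≼
  reflecting : ∀ {x y} → Maybe.map ι x ≼ Maybe.map ι y → x ≼ y
  reflecting {nothing} _             = root≼
  reflecting {just i}  {just j} ιi≼ιj =
    subst (λ l → just i ≼ just l) (ι-injective (just≼just⇒≡ ιi≼ιj)) leaf≼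
  ⋏-hom : ∀ x y → Maybe.map ι (x ⋏ y) ≡ Maybe.map ι x ⋏ Maybe.map ι y
  ⋏-hom nothing  y        = refl
  ⋏-hom (just i) nothing  = refl
  ⋏-hom (just i) (just j) with i ≟ j
  ... | yes refl = sym (⋏-self (ι i))
  ... | no i≢j   = sym (⋏-≢ (i≢j ∘ ι-injective))

star-permutation-automorphism : (π : Permutation′ n) → IsAutomorphism (star n) (Maybe.map (π ⟨$⟩ʳ_))
star-permutation-automorphism π = record
  { bijective = map-injective π-injective
              , strictlySurjective⇒surjective (λ y → Maybe.map (π ⟨$⟩ˡ_) y , map-inverseʳ y)
  ; embedding = star-map-embedding π-injective }
  where
  open ≡-Reasoning
  π-injective : Injective _≡_ _≡_ (π ⟨$⟩ʳ_)
  π-injective = Injection.injective (↔⇒↣ π)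
  map-inverseʳ : ∀ y → Maybe.map (π ⟨$⟩ʳ_) (Maybe.map (π ⟨$⟩ˡ_) y) ≡ y
  map-inverseʳ y = begin
    Maybe.map (π ⟨$⟩ʳ_) (Maybe.map (π ⟨$⟩ˡ_) y) ≡⟨ map-∘ y ⟨
    Maybe.map (λ i → π ⟨$⟩ʳ (π ⟨$⟩ˡ i)) y      ≡⟨ map-cong (λ _ → inverseʳ π) y ⟩
    Maybe.map (λ i → i) y                      ≡⟨ map-id y ⟩
    y                                          ∎

star-image : ∀ {T : MeetTree} {e : Maybe (Fin n) → Carrier T} → IsMeetTreeEmbedding (star n) T e →
             MeetTreeProperties.IsStar T (e ∘ just) (e nothing)
star-image {T = T} {e} e-embedding = meets , leaves
  where
  open IsMeetTreeEmbedding e-embedding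
  meets : ∀ i j → i ≢ j → _∧_ T (e (just i)) (e (just j)) ≡ e nothing
  meets i j i≢j = trans (sym (∧-hom (just i) (just j))) (cong e (⋏-≢ i≢j))
  leaves : ∀ i → e (just i) ≢ e nothing
  leaves i eᵢ≡e₀ with () ← injective eᵢ≡e₀

starAut : 1 ≤ℕ k → n ≤ℕ k → Permutation′ n → TreeAut k
starAut 1≤k n≤k π = record
  { tree  = star _
  ; arity = star-arity 1≤k n≤k
  ; aut   = Maybe.map (π ⟨$⟩ʳ_)
  ; isAut = star-permutation-automorphism π }

module Counterexample (1<k : 1 < k) where
  point swapped-pair fixed-star : TreeAut k
  point        = starAut (<⇒≤ 1<k) z≤n id
  swapped-pair = starAut (<⇒≤ 1<k) 1<k (transpose zero (suc zero))
  fixed-star   = starAut (<⇒≤ 1<k) ≤ℕ-refl id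

  point↪star : ∀ (n≤k : n ≤ℕ k) π → Emb point (starAut (<⇒≤ 1<k) n≤k π)
  point↪star _ _ = record
    { map   = Maybe.map λ ()
    ; isEmb = star-map-embedding λ {}
    ; comm  = λ { nothing → refl } }

  point↪swapped-pair : Emb point swapped-pair
  point↪swapped-pair = point↪star 1<k (transpose zero (suc zero))

  point↪fixed-star : Emb point fixed-star
  point↪fixed-star = point↪star ≤ℕ-refl id

  no-amalgam : (D : TreeAut k) (j₁ : Emb swapped-pair D) (j₂ : Emb fixed-star D) →
               map j₁ nothing ≡ map j₂ nothing → ⊥
  no-amalgam D j₁ j₂ roots≡ = arity⇒¬star (arity D) (star-∷ b-star a≢r a⊓b≡r)
    where
    open MeetTreeProperties (tree D)
    open ≡-Reasoning
    h = aut D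
    r = map j₂ nothing
    a = map j₁ (just zero)
    b = map j₂ ∘ just
    pair-star : IsStar (map j₁ ∘ just) (map j₁ nothing)
    pair-star = star-image (isEmb j₁)
    b-star : IsStar b r
    b-star = star-image (isEmb j₂)
    a≢r : a ≢ r
    a≢r = subst (a ≢_) roots≡ (proj₂ pair-star zero)
    a⊓ha≡r : a ⊓ h a ≡ r
    a⊓ha≡r = begin
      a ⊓ h a                      ≡⟨ cong (a ⊓_) (comm j₁ (just zero)) ⟨
      a ⊓ map j₁ (just (suc zero)) ≡⟨ proj₁ pair-star zero (suc zero) (λ ()) ⟩
      map j₁ nothing               ≡⟨ roots≡ ⟩
      r                            ∎
    r⊑b : ∀ j → r ⊑ b j
    r⊑b j = Equivalence.to (IsMeetTreeEmbedding.≤-iff (isEmb j₂) nothing (just j)) root≼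
    a⊓b≡r : ∀ j → a ⊓ b j ≡ r
    a⊓b≡r j = ⊓-fixed-point (IsAutomorphism.embedding (isAut D))
                (sym (comm j₂ nothing)) (sym (comm j₂ (just j))) (r⊑b j) a⊓ha≡r

proposition4p17 : ∀ (k : ℕ) → 1 < k → ¬ AmalgamationProperty k
proposition4p17 k 1<k amalgamation =
  let D , j₁ , j₂ , agree = amalgamation point swapped-pair fixed-star point↪swapped-pair point↪fixed-star
  in  no-amalgam D j₁ j₂ (agree nothing)
  where open Counterexample 1<k
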